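{- Fix $k\ge2$ and write $A_xy=A_x(k,y)$. If $m\equiv_k A_ab$ with $a>0$, $(c_i)_{i\le a}$ is the left expansion sequence for $A_ab$, and $i\in[1,a]$, then \[b<c_{i-1}<c_i<m=A_{a-i}^kc_{i-1}<A_{a-i+1}c_{i-1}.\]
   Context: Ackermann function: for $k\ge 2$, $a,b\ge 0$: $A_a(k,-1):=1$, $A_0(k,b):=k^b$, $A_{a+1}(k,b):=A_a(k,\cdot)^k(A_{a+1}(k,b-1))$; $A_x^jy$ denotes the $j$-fold iterate of $y\mapsto A_xy$. $k$-normal form: for $m>0$, $m\equiv_k A_ab+c$ means $m=A_ab+c$ and there exist $n\ge1$ and naturals $a_1..a_n$, $b_1..b_n$, $m_0..m_n$ with $m_0=0$; for $0\le i<n$: $A_{a_{i+1}}m_i\le m<A_{a_{i+1}+1}m_i$, $A_{a_{i+1}}b_{i+1}\le m<A_{a_{i+1}}(b_{i+1}+1)$, $m_{i+1}=A_{a_{i+1}}b_{i+1}$; $A_0m_n>m$; $a=a_n$, $b=b_n$. $m\equiv_k A_ab$ means $m\equiv_k A_ab+0$. Left expansion sequence: for $A_ab$ in normal form with $a>0$, define $c_0=A_a(b-1)$ (using $A_a(-1)=1$ if $b=0$) and $c_i=A_{a-i}\big(A_{a-i}^{k-1}c_{i-1}-1\big)$ for $1\le i\le a$. -}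

module Defs where

open import Data.Nat using (ℕ; zero; suc; _+_; _∸_; _^_; _≤_; _<_)
open import Data.Product using (Σ; _×_; ∃-syntax)

iter : ℕ → (ℕ → ℕ) → ℕ → ℕ
iter zero    f y = y
iter (suc j) f y = f (iter j f y)

-- Shifted Ackermann: A⁺ k a n = A_a(k, n - 1), so that the value at
-- the argument -1 (n = 0) is representable.
--   A_a(k,-1) = 1,  A_0(k,b) = k^b,
--   A_{a+1}(k,b) = A_a(k,·)^k (A_{a+1}(k,b-1)).
A⁺ : ℕ → ℕ → ℕ → ℕ
A⁺ k a       zero    = 1
A⁺ k zero    (suc b) = k ^ b
A⁺ k (suc a) (suc b) = iter k (λ y → A⁺ k a (suc y)) (A⁺ k (suc a) b)

A : ℕ → ℕ → ℕ → ℕ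
A k a b = A⁺ k a (suc b)

-- k-normal form:  m ≡_k A_a b + c  (the hypothesis m > 0 is stated separately).
-- Sequences a_i, b_i (used for 1 ≤ i ≤ n) and m_i (0 ≤ i ≤ n) are given as
-- functions ℕ → ℕ; values outside these ranges are irrelevant.
NormalForm : (k m a b c : ℕ) → Set
NormalForm k m a b c =
  (m ≡ A k a b + c) ×
  ∃[ n ] Σ (ℕ → ℕ) λ as → Σ (ℕ → ℕ) λ bs → Σ (ℕ → ℕ) λ ms →
    (1 ≤ n) × (ms 0 ≡ 0) ×
    ((i : ℕ) → i < n →
        (A k (as (suc i)) (ms i) ≤ m) × (m < A k (suc (as (suc i))) (ms i)) ×
        (A k (as (suc i)) (bs (suc i)) ≤ m) × (m < A k (as (suc i)) (suc (bs (suc i)))) ×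
        (ms (suc i) ≡ A k (as (suc i)) (bs (suc i)))) ×
    (m < A k 0 (ms n)) × (a ≡ as n) × (b ≡ bs n)
  where open import Relation.Binary.PropositionalEquality using (_≡_)

-- Left expansion sequence for A_a b:
--   c_0 = A_a(b-1),  c_i = A_{a-i}(A_{a-i}^{k-1} c_{i-1} - 1).
-- (Truncated subtraction is harmless: all values of A are ≥ 1.)
lexp : (k a b : ℕ) → ℕ → ℕ
lexp k a b zero    = A⁺ k a b
lexp k a b (suc i) =
  A k (a ∸ suc i) (iter (k ∸ 1) (A k (a ∸ suc i)) (lexp k a b i) ∸ 1)

module Submission where

-- Since A_{j+1} y = A_j^k (A_{j+1} (y - 1)), unfolding the outermost application in
-- A_{j+1}^k c = A_{j+1} (A_{j+1}^{k-1} c) turns it into A_j^k c', where c' is the next term of the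
-- left expansion; hence m = A_{a-i}^k c_{i-1} for every i ≤ a. The inequalities then follow from
-- y < A_j y and the strict monotonicity of A_j, both of which use k ≥ 2.

open import Defs
open import Data.Nat using (ℕ; zero; suc; _+_; _∸_; _^_; _≤_; _<_; z≤n; s≤s; z<s)
open import Data.Nat.Properties
open import Data.Product using (_×_; _,_)
open import Data.Sum using (inj₁; inj₂)
open import Relation.Binary.PropositionalEquality using (_≡_; refl; trans; cong; module ≡-Reasoning)

iter-pred : ∀ {n f x} → 0 < n → iter n f x ≡ f (iter (n ∸ 1) f x)
iter-pred {suc n} _ = refl

iter-inflationary : ∀ {f} → (∀ y → y < f y) → ∀ n x → n + x ≤ iter n f x
iter-inflationary f-infl zero    x = ≤-refl
iter-inflationary f-infl (suc n) x = ≤-trans (s≤s (iter-inflationary f-infl n x)) (f-infl _)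

iter-strictly-inflationary : ∀ {f n} → (∀ y → y < f y) → 0 < n → ∀ x → x < iter n f x
iter-strictly-inflationary {n = n} f-infl n>0 x =
  ≤-trans (+-monoˡ-≤ x n>0) (iter-inflationary f-infl n x)

iter-mono-< : ∀ {f} → (∀ {x y} → x < y → f x < f y) → ∀ n {x y} → x < y → iter n f x < iter n f y
iter-mono-< f-mono zero    x<y = x<y
iter-mono-< f-mono (suc n) x<y = f-mono (iter-mono-< f-mono n x<y)

<-suc⇒mono-< : ∀ {f : ℕ → ℕ} → (∀ y → f y < f (suc y)) → ∀ {y z} → y < z → f y < f z
<-suc⇒mono-< {f} f-step {y} {suc z} (s≤s y≤z) with m≤n⇒m<n∨m≡n y≤z
... | inj₁ y<z  = <-trans (<-suc⇒mono-< f-step y<z) (f-step z)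
... | inj₂ refl = f-step y

A-suc-unfold : ∀ k j {x} → 0 < x → A k (suc j) x ≡ iter k (A k j) (A k (suc j) (x ∸ 1))
A-suc-unfold k j {suc x} _ = refl

module _ {k : ℕ} (2≤k : 2 ≤ k) where

  k>0 : 0 < k
  k>0 = ≤-trans (s≤s z≤n) 2≤k

  k∸1>0 : 0 < k ∸ 1
  k∸1>0 = ∸-monoˡ-≤ 1 2≤k

  n<k^n : ∀ n → n < k ^ n
  n<k^n zero    = z<s
  n<k^n (suc n) = ≤-<-trans (n<k^n n) (^-monoʳ-< k 2≤k (n<1+n n))

  A⁺-inflationary : ∀ a n → n ≤ A⁺ k a n
  A⁺-suc-strictly-inflationary : ∀ a n → n < A⁺ k (suc a) n

  A⁺-inflationary zero    zero    = z≤n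
  A⁺-inflationary zero    (suc b) = n<k^n b
  A⁺-inflationary (suc a) n       = <⇒≤ (A⁺-suc-strictly-inflationary a n)

  A⁺-suc-strictly-inflationary a zero    = z<s
  A⁺-suc-strictly-inflationary a (suc b) =
    ≤-trans (+-mono-≤ 2≤k (<⇒≤ (A⁺-suc-strictly-inflationary a b)))
            (iter-inflationary (λ y → A⁺-inflationary a (suc y)) k _)

  A-inflationary : ∀ a y → y < A k a y
  A-inflationary a y = A⁺-inflationary a (suc y)

  A-<-suc : ∀ a y → A k a y < A k a (suc y)
  A-<-suc zero    y = ^-monoʳ-< k 2≤k (n<1+n y)
  A-<-suc (suc a) y = <-≤-trans (m<n+m _ k>0) (iter-inflationary (A-inflationary a) k _)

  A-mono-< : ∀ a {y z} → y < z → A k a y < A k a z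
  A-mono-< a = <-suc⇒mono-< (A-<-suc a)

  iter-A<A-suc : ∀ j c → iter k (A k j) c < A k (suc j) c
  iter-A<A-suc j c = iter-mono-< (A-mono-< j) k (A⁺-suc-strictly-inflationary j c)

  <-iter[k∸1]-A : ∀ j c → c < iter (k ∸ 1) (A k j) c
  <-iter[k∸1]-A j = iter-strictly-inflationary (A-inflationary j) k∸1>0

  -- Stated for i ≡ suc j so that the right-hand side is literally iter k (A k j) c_{t+1} when i = a ∸ suc t.
  iter-A-expand : ∀ {i j} c → i ≡ suc j →
    iter k (A k i) c ≡ iter k (A k j) (A k i (iter (k ∸ 1) (A k i) c ∸ 1))
  iter-A-expand {j = j} c refl = begin
    iter k (A k (suc j)) c                ≡⟨ iter-pred k>0 ⟩
    A k (suc j) x                         ≡⟨ A-suc-unfold k j x>0 ⟩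
    iter k (A k j) (A k (suc j) (x ∸ 1))  ∎
    where
      open ≡-Reasoning
      x = iter (k ∸ 1) (A k (suc j)) c
      x>0 : 0 < x
      x>0 = m<n⇒0<n (<-iter[k∸1]-A (suc j) c)

  A≡iter-lexp : ∀ {a b t} → t < a → A k a b ≡ iter k (A k (a ∸ suc t)) (lexp k a b t)
  A≡iter-lexp {suc a} {t = zero}  _    = refl
  A≡iter-lexp {a} {b} {suc t} t<a =
    trans (A≡iter-lexp (<-trans (n<1+n t) t<a))
          (iter-A-expand (lexp k a b t) (+-∸-assoc 1 t<a))

  lexp-<-suc : ∀ a b t → lexp k a b t < lexp k a b (suc t)
  lexp-<-suc a b t = ≤-<-trans (<⇒≤pred (<-iter[k∸1]-A j c)) (A-inflationary j _)
    where
      j = a ∸ suc t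
      c = lexp k a b t

  b<lexp : ∀ {a b} → 0 < a → ∀ t → b < lexp k a b t
  b<lexp {suc a} {b} _   zero    = A⁺-suc-strictly-inflationary a b
  b<lexp {a}     {b} a>0 (suc t) = <-trans (b<lexp a>0 t) (lexp-<-suc a b t)

  lexp-suc<A : ∀ {a b t} → t < a → lexp k a b (suc t) < A k a b
  lexp-suc<A {a} {b} {t} t<a = begin-strict
    lexp k a b (suc t)  ≡⟨⟩
    A k j (x ∸ 1)       <⟨ A-mono-< j (∸-monoʳ-< z<s x>0) ⟩
    A k j x             ≡⟨ iter-pred k>0 ⟨
    iter k (A k j) c    ≡⟨ A≡iter-lexp t<a ⟨
    A k a b             ∎
    where
      open ≤-Reasoning
      j = a ∸ suc t
      c = lexp k a b t
      x = iter (k ∸ 1) (A k j) c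
      x>0 : 0 < x
      x>0 = m<n⇒0<n (<-iter[k∸1]-A j c)

lemma4p3 : (k : ℕ) → 2 ≤ k → (m a b : ℕ) → 0 < m → NormalForm k m a b 0 → 0 < a →
    (i : ℕ) → 1 ≤ i → i ≤ a →
      (b < lexp k a b (i ∸ 1)) × (lexp k a b (i ∸ 1) < lexp k a b i) ×
      (lexp k a b i < m) × (m ≡ iter k (A k (a ∸ i)) (lexp k a b (i ∸ 1))) ×
      (m < A k (a ∸ i + 1) (lexp k a b (i ∸ 1)))
lemma4p3 k 2≤k m a b _ (m≡A+0 , _) a>0 (suc t) _ t<a rewrite m≡A+0 | +-identityʳ (A k a b) =
  b<lexp 2≤k a>0 t , lexp-<-suc 2≤k a b t , lexp-suc<A 2≤k t<a , A≡iter-lexp 2≤k t<a , A<A-next-level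
  where
    open ≤-Reasoning
    j = a ∸ suc t
    c = lexp k a b t
    A<A-next-level : A k a b < A k (j + 1) c
    A<A-next-level = begin-strict
      A k a b             ≡⟨ A≡iter-lexp 2≤k t<a ⟩
      iter k (A k j) c    <⟨ iter-A<A-suc 2≤k j c ⟩
      A k (suc j) c       ≡⟨ cong (λ l → A k l c) (+-comm 1 j) ⟩
      A k (j + 1) c       ∎
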